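{- Let $G$ be a directed graph with $P$ vertices and let $C$ be a communication graph for universal broadcast on $G$ with time $\tau=\tau(C)$. Suppose that at most $Q$ directed edges of $G$ can be used simultaneously, i.e. for every time $t$ at most $Q$ edges occurring in the task graphs of $C$ carry the label $t$. Then $\tau\ge \frac{P(P-1)}{Q}$.
   Context: A task graph on $G$ is a finite sequence $(e_i)$ of directed edges of $G$ labeled by positive integer times $t(e_i)$ such that (i) $t(e_i)<t(e_j)$ implies $e_i<e_j$ or $e_i,e_j$ incomparable, and (ii) $t(e_i)=t(e_j)$ implies $i=j$ or $e_i,e_j$ incomparable, where $e_i<e_j$ means there is a directed path in the task graph beginning with $e_i$ and ending with $e_j$. Its time is the maximum label. A communication graph is a collection of task graphs such that no directed edge of $G$ carries a given label more than once in the whole collection; its time $\tau(C)$ is the maximum of the times of its task graphs. A broadcast from a vertex $v$ is a task graph containing a directed path from $v$ to every other vertex. A communication graph for universal broadcast consists of a broadcast from each vertex of $G$. -}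

module Defs where

open import Data.Nat using (ℕ; zero; suc; _+_; _*_; _∸_; _≤_; _<_; _⊔_; _≟_)
open import Data.Fin using (Fin; toℕ)
open import Data.List using (List; length; lookup; foldr; map; filter; allFin)
open import Data.Nat.ListAction using (sum)
open import Data.List.Relation.Unary.All using (All)
open import Data.Product using (_×_; Σ)
open import Data.Sum using (_⊎_)
open import Relation.Nullary using (¬_)
open import Relation.Binary.PropositionalEquality using (_≡_; _≢_)

-- A (simple) directed graph on the vertex set Fin P: E u v means there is a
-- directed edge u → v.  A directed edge is identified by its endpoints.
record Digraph (P : ℕ) : Set₁ where
  field
    E : Fin P → Fin P → Set

module _ {P : ℕ} (G : Digraph P) where
  open Digraph G

  record LEdge : Set where
    constructor ledge
    field
      src   : Fin P
      tgt   : Fin P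
      edge  : E src tgt
      label : ℕ

  TaskSeq : Set
  TaskSeq = List LEdge

open LEdge public

module _ {P : ℕ} {G : Digraph P} (T : TaskSeq G) where

  Idx : Set
  Idx = Fin (length T)

  ent : Idx → LEdge G
  ent = lookup T

  Adj : Idx → Idx → Set
  Adj i j = tgt (ent i) ≡ src (ent j)

  data _≺_ : Idx → Idx → Set where
    step : ∀ {i j} → Adj i j → i ≺ j
    _∷_  : ∀ {i k j} → Adj i k → k ≺ j → i ≺ j

  Incomparable : Idx → Idx → Set
  Incomparable i j = ¬ (i ≺ j) × ¬ (j ≺ i)

  t : Idx → ℕ
  t i = label (ent i)

  IsTaskGraph : Set
  IsTaskGraph =
      All (λ e → 0 < label e) T
    × (∀ i j → t i < t j → (i ≺ j) ⊎ Incomparable i j)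
    × (∀ i j → t i ≡ t j → (i ≡ j) ⊎ Incomparable i j)

  time : ℕ
  time = foldr _⊔_ 0 (map label T)

  data Reach : Fin P → Fin P → Set where
    one  : ∀ i → Reach (src (ent i)) (tgt (ent i))
    _∷_  : ∀ {w} i → Reach (tgt (ent i)) w → Reach (src (ent i)) w

  IsBroadcast : Fin P → Set
  IsBroadcast v = IsTaskGraph × (∀ w → w ≢ v → Reach v w)

module _ {P : ℕ} {G : Digraph P} where

  Collection : Set
  Collection = Fin P → TaskSeq G

  LabelsUnique : Collection → Set
  LabelsUnique C =
    ∀ v (i : Idx (C v)) v' (i' : Idx (C v')) →
      src (ent (C v) i) ≡ src (ent (C v') i') →
      tgt (ent (C v) i) ≡ tgt (ent (C v') i') →
      t (C v) i ≡ t (C v') i' →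
      (v ≡ v') × (toℕ i ≡ toℕ i')

  IsUniversalBroadcast : Collection → Set
  IsUniversalBroadcast C = (∀ v → IsBroadcast (C v) v) × LabelsUnique C

  τ : Collection → ℕ
  τ C = foldr _⊔_ 0 (map (λ v → time (C v)) (allFin P))

  load : Collection → ℕ → ℕ
  load C s = sum (map (λ v → length (filter (λ e → label e ≟ s) (C v))) (allFin P))

-- Each broadcast from v must deliver to the P − 1 other vertices, and the last edge of a path
-- into w ends at w, so a broadcast has at least P − 1 edges and C has at least P(P − 1) edge
-- occurrences.  All labels lie in 1, …, τ and each label is carried by at most Q of them, so
-- there are at most τ Q.

module Submission where

open import Defs
open import Data.Nat using (ℕ; zero; suc; _+_; _*_; _∸_; _≤_; _<_; _⊔_; _≤?_; _≟_; z≤n; s≤s)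
open import Data.Nat.Properties
open import Data.Fin using (Fin; punchIn)
open import Data.Fin.Properties using (punchIn-injective; punchInᵢ≢i; injective⇒≤)
open import Data.List using (List; []; _∷_; length; map; filter; foldr; allFin)
open import Data.List.Properties using (map-cong; length-tabulate; filter-accept; filter-reject; filter-all; filter-none)
open import Data.Nat.ListAction using (sum)
open import Data.List.Relation.Unary.All as All using (All; []; _∷_)
open import Data.List.Relation.Unary.All.Properties using (map⁻)
open import Data.List.Membership.Propositional.Properties using (∈-allFin)
open import Data.Product using (Σ; _,_; proj₁; proj₂)
open import Data.Sum using (_⊎_; [_,_]′; map₁)
open import Data.Empty using (⊥-elim)
import Algebra.Properties.CommutativeSemigroup
open import Relation.Nullary using (¬_; yes; no)
open import Relation.Unary using (Pred; Decidable)
open import Relation.Binary.PropositionalEquality using (_≡_; refl; sym; trans; cong; module ≡-Reasoning)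

module _ {A : Set} where

  sum-map-+ : (f g : A → ℕ) (xs : List A) →
    sum (map (λ x → f x + g x) xs) ≡ sum (map f xs) + sum (map g xs)
  sum-map-+ f g [] = refl
  sum-map-+ f g (x ∷ xs) = trans (cong (f x + g x +_) (sum-map-+ f g xs))
                                 (+-interchange (f x) (g x) (sum (map f xs)) (sum (map g xs)))
    where open Algebra.Properties.CommutativeSemigroup +-commutativeSemigroup
                 using () renaming (interchange to +-interchange)

  sum-map-mono : (f g : A → ℕ) (xs : List A) → (∀ x → f x ≤ g x) → sum (map f xs) ≤ sum (map g xs)
  sum-map-mono f g [] _ = z≤n
  sum-map-mono f g (x ∷ xs) f≤g = +-mono-≤ (f≤g x) (sum-map-mono f g xs f≤g)

  sum-map-const : (c : ℕ) (xs : List A) → sum (map (λ _ → c) xs) ≡ length xs * c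
  sum-map-const c [] = refl
  sum-map-const c (x ∷ xs) = cong (c +_) (sum-map-const c xs)

  length-filter-⊎ : ∀ {p} {P Q R : Pred A p} (P? : Decidable P) (Q? : Decidable Q) (R? : Decidable R) →
    (∀ {x} → P x → Q x ⊎ R x) → (∀ {x} → Q x → P x) → (∀ {x} → R x → P x) →
    (∀ {x} → Q x → ¬ R x) →
    ∀ xs → length (filter P? xs) ≡ length (filter Q? xs) + length (filter R? xs)
  length-filter-⊎ P? Q? R? P⇒Q⊎R Q⇒P R⇒P Q⇒¬R [] = refl
  length-filter-⊎ P? Q? R? P⇒Q⊎R Q⇒P R⇒P Q⇒¬R (x ∷ xs)
    with ih ← length-filter-⊎ P? Q? R? P⇒Q⊎R Q⇒P R⇒P Q⇒¬R xs | Q? x | R? x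
  ... | yes q | yes r = ⊥-elim (Q⇒¬R q r)
  ... | yes q | no ¬r
    rewrite filter-accept P? {xs = xs} (Q⇒P q) = cong suc ih
  ... | no ¬q | yes r
    rewrite filter-accept P? {xs = xs} (R⇒P r)
    = trans (cong suc ih) (sym (+-suc _ _))
  ... | no ¬q | no ¬r
    rewrite filter-reject P? {xs = xs} (λ p → [ ¬q , ¬r ]′ (P⇒Q⊎R p)) = ih

All≤foldr-⊔ : (xs : List ℕ) → All (_≤ foldr _⊔_ 0 xs) xs
All≤foldr-⊔ [] = []
All≤foldr-⊔ (x ∷ xs) = m≤m⊔n x _ ∷ All.map (λ x≤ → ≤-trans x≤ (m≤n⊔m x _)) (All≤foldr-⊔ xs)

module _ {P : ℕ} {G : Digraph P} where

  #label≤ : ℕ → TaskSeq G → ℕ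
  #label≤ k T = length (filter (λ e → label e ≤? k) T)

  #label≤-suc : ∀ k (T : TaskSeq G) →
    #label≤ (suc k) T ≡ #label≤ k T + length (filter (λ e → label e ≟ suc k) T)
  #label≤-suc k = length-filter-⊎ (λ e → label e ≤? suc k) (λ e → label e ≤? k) (λ e → label e ≟ suc k)
    (λ m≤ → map₁ m<1+n⇒m≤n (m≤n⇒m<n∨m≡n m≤)) m≤n⇒m≤1+n ≤-reflexive (λ ≤k ≡suc → <-irrefl ≡suc (s≤s ≤k))

  #label≤-zero : (T : TaskSeq G) → All (λ e → 0 < label e) T → #label≤ 0 T ≡ 0
  #label≤-zero T pos = cong length (filter-none (λ e → label e ≤? 0) (All.map <⇒≱ pos))

  #label≤-all : ∀ k (T : TaskSeq G) → All (λ e → label e ≤ k) T → #label≤ k T ≡ length T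
  #label≤-all k T ≤k = cong length (filter-all (λ e → label e ≤? k) ≤k)

  Reach⇒incoming : {T : TaskSeq G} {u w : Fin P} → Reach T u w → Σ (Idx T) (λ i → tgt (ent T i) ≡ w)
  Reach⇒incoming (one i) = i , refl
  Reach⇒incoming (i ∷ r) = Reach⇒incoming r

broadcast-length : ∀ {P} {G : Digraph P} {T : TaskSeq G} {v : Fin P} → IsBroadcast T v → P ∸ 1 ≤ length T
broadcast-length {zero} _ = z≤n
broadcast-length {suc n} {T = T} {v} (_ , reach) = injective⇒≤ {f = last-edge-into} last-edge-into-injective
  where
  incoming : (j : Fin n) → Σ (Idx T) (λ i → tgt (ent T i) ≡ punchIn v j)
  incoming j = Reach⇒incoming (reach (punchIn v j) (punchInᵢ≢i v j))

  last-edge-into : Fin n → Idx T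
  last-edge-into j = proj₁ (incoming j)

  last-edge-into-injective : ∀ {j k} → last-edge-into j ≡ last-edge-into k → j ≡ k
  last-edge-into-injective {j} {k} same = punchIn-injective v j k
    (trans (sym (proj₂ (incoming j))) (trans (cong (λ i → tgt (ent T i)) same) (proj₂ (incoming k))))

module _ {P : ℕ} {G : Digraph P} (C : Collection {P} {G}) where

  label≤τ : ∀ v → All (λ e → label e ≤ τ C) (C v)
  label≤τ v = All.map (λ ≤time → ≤-trans ≤time time≤τ) (map⁻ (All≤foldr-⊔ (map label (C v))))
    where
    time≤τ : time (C v) ≤ τ C
    time≤τ = All.lookup (map⁻ (All≤foldr-⊔ (map (λ v → time (C v)) (allFin P)))) (∈-allFin v)

  sum-#label≤-bounded : (∀ v → All (λ e → 0 < label e) (C v)) → ∀ {Q} → (∀ s → load C s ≤ Q) →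
    ∀ k → sum (map (λ v → #label≤ k (C v)) (allFin P)) ≤ k * Q
  sum-#label≤-bounded pos {Q} load≤Q zero = ≤-reflexive (begin
    sum (map (λ v → #label≤ 0 (C v)) (allFin P)) ≡⟨ cong sum (map-cong (λ v → #label≤-zero (C v) (pos v)) (allFin P)) ⟩
    sum (map (λ _ → 0) (allFin P))               ≡⟨ sum-map-const 0 (allFin P) ⟩
    length (allFin P) * 0                         ≡⟨ *-zeroʳ (length (allFin P)) ⟩
    0                                             ∎)
    where open ≡-Reasoning
  sum-#label≤-bounded pos {Q} load≤Q (suc k) = begin
    sum (map (λ v → #label≤ (suc k) (C v)) (allFin P))
      ≡⟨ cong sum (map-cong (λ v → #label≤-suc k (C v)) (allFin P)) ⟩
    sum (map (λ v → #label≤ k (C v) + length (filter (λ e → label e ≟ suc k) (C v))) (allFin P))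
      ≡⟨ sum-map-+ (λ v → #label≤ k (C v)) (λ v → length (filter (λ e → label e ≟ suc k) (C v))) (allFin P) ⟩
    sum (map (λ v → #label≤ k (C v)) (allFin P)) + load C (suc k)
      ≤⟨ +-mono-≤ (sum-#label≤-bounded pos load≤Q k) (load≤Q (suc k)) ⟩
    k * Q + Q
      ≡⟨ +-comm (k * Q) Q ⟩
    suc k * Q ∎
    where open ≤-Reasoning

theorem3p1 : (P : ℕ) (G : Digraph P) (C : Collection {P} {G}) (Q : ℕ) →
    IsUniversalBroadcast C →
    (∀ s → load C s ≤ Q) →
    P * (P ∸ 1) ≤ τ C * Q
theorem3p1 P G C Q (broadcast , _) load≤Q = begin
  P * (P ∸ 1)
    ≡⟨ cong (_* (P ∸ 1)) (length-tabulate {n = P} (λ v → v)) ⟨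
  length (allFin P) * (P ∸ 1)
    ≡⟨ sum-map-const (P ∸ 1) (allFin P) ⟨
  sum (map (λ _ → P ∸ 1) (allFin P))
    ≤⟨ sum-map-mono _ _ (allFin P) (λ v → broadcast-length (broadcast v)) ⟩
  sum (map (λ v → length (C v)) (allFin P))
    ≡⟨ cong sum (map-cong (λ v → #label≤-all (τ C) (C v) (label≤τ C v)) (allFin P)) ⟨
  sum (map (λ v → #label≤ (τ C) (C v)) (allFin P))
    ≤⟨ sum-#label≤-bounded C (λ v → proj₁ (proj₁ (broadcast v))) load≤Q (τ C) ⟩
  τ C * Q ∎
  where open ≤-Reasoning
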